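{- Let $G$ be a finite simple graph, and let $g,f:V(G)\rightarrow \mathbb{Z}^{+}$ be two functions with $g(x)\leq f(x)\leq d_G(x)$ for each vertex $x\in V(G)$. If $g(x)d_G(y)\geq d_G(x)f(y)$ holds for any $x,y\in V(G)$, then $G$ contains all fractional $(g,f)$-factors.
   Context: Graphs are finite, undirected, without loops or multiple edges. $\mathbb{Z}^{+}$ denotes the positive integers and $N$ the nonnegative integers. For $x\in V(G)$, $d_G(x)$ is the degree of $x$ in $G$ and $E(x)$ is the set of edges of $G$ incident with $x$. For $r:V(G)\rightarrow N$, a fractional $r$-factor of $G$ is given by a function $h:E(G)\rightarrow[0,1]$ with $\sum_{e\in E(x)}h(e)=r(x)$ for every $x\in V(G)$. $G$ contains all fractional $(g,f)$-factors if $G$ has a fractional $r$-factor for every $r:V(G)\rightarrow N$ with $g(x)\leq r(x)\leq f(x)$ for each $x\in V(G)$. -}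

module Defs where

open import Data.Nat using (ℕ; _≤_)
open import Data.Bool using (Bool; true; false; if_then_else_)
open import Data.Fin using (Fin)
open import Data.List using (List; map; foldr; allFin)
open import Data.Nat.ListAction using (sum)
open import Data.Integer using (+_)
open import Data.Rational using (ℚ; 0ℚ; 1ℚ; _/_) renaming (_+_ to _+ℚ_; _≤_ to _≤ℚ_)
open import Data.Product using (_×_; ∃)
open import Relation.Binary.PropositionalEquality using (_≡_)

record Graph : Set where
  field
    n         : ℕ
    adj       : Fin n → Fin n → Bool
    adj-sym   : ∀ x y → adj x y ≡ adj y x
    adj-irr   : ∀ x → adj x x ≡ false

open Graph public

deg : (G : Graph) → Fin (n G) → ℕ
deg G x = sum (map (λ y → if adj G x y then 1 else 0) (allFin (n G)))

-- Σ_{e ∈ E(x)} h(e), edges xy encoded as ordered pairs (x , y) with adj x y.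
sumE : (G : Graph) → (Fin (n G) → Fin (n G) → ℚ) → Fin (n G) → ℚ
sumE G h x = foldr _+ℚ_ 0ℚ (map (λ y → if adj G x y then h x y else 0ℚ) (allFin (n G)))

IsFractionalFactor : (G : Graph) → (Fin (n G) → ℕ) → (Fin (n G) → Fin (n G) → ℚ) → Set
IsFractionalFactor G r h =
  (∀ x y → adj G x y ≡ true → (h x y ≡ h y x) × (0ℚ ≤ℚ h x y) × (h x y ≤ℚ 1ℚ))
  × (∀ x → sumE G h x ≡ (+ (r x)) / 1)

HasFractionalFactor : (G : Graph) → (Fin (n G) → ℕ) → Set
HasFractionalFactor G r = ∃ λ h → IsFractionalFactor G r h

ContainsAllFractionalFactors : (G : Graph) → (g f : Fin (n G) → ℕ) → Set
ContainsAllFractionalFactors G g f =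
  (r : Fin (n G) → ℕ) → (∀ x → (g x ≤ r x) × (r x ≤ f x)) → HasFractionalFactor G r

module Submission where

-- Applying the hypothesis to any pair x, y and then using g ≤ r ≤ f gives
-- d(x) r(y) ≤ r(x) d(y) for every admissible r, hence, by symmetry,
-- r(x)/d(x) is the same constant for all vertices. Giving every edge at x the
-- weight r(x)/d(x) is then well defined (the two endpoints agree), lies in
-- [0,1] because r ≤ d, and sums to r(x) over the d(x) edges at x.

open import Data.Bool using (Bool; true; false; if_then_else_)
open import Data.Fin using (Fin)
open import Data.List using (List; []; _∷_; map; foldr; allFin)
open import Data.Nat as ℕ using (ℕ; suc; _≤_; _<_; _*_; NonZero)
import Data.Nat.Properties as ℕₚ
open import Data.Nat.ListAction using (sum)
open import Data.Integer as ℤ using (ℤ; +_)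
import Data.Integer.Properties as ℤₚ
open import Data.Integer.Tactic.RingSolver using (solve-∀)
open import Data.Rational using (ℚ; 0ℚ; 1ℚ; _/_; toℚᵘ)
  renaming (_+_ to _+ℚ_; _*_ to _*ℚ_; _≤_ to _≤ℚ_)
import Data.Rational.Properties as ℚₚ
open import Data.Rational.Unnormalised as ℚᵘ using (mkℚᵘ; *≡*; *≤*)
import Data.Rational.Unnormalised.Properties as ℚᵘₚ
open import Data.Product using (_×_; _,_; proj₁; proj₂)
open import Relation.Binary.PropositionalEquality

open import Defs

fromℕ : ℕ → ℚ
fromℕ n = + n / 1

toℚᵘ-/ : ∀ i d .{{_ : NonZero d}} → toℚᵘ (i / d) ℚᵘ.≃ (i ℚᵘ./ d)
toℚᵘ-/ i (suc k) = ℚₚ.toℚᵘ-fromℚᵘ (mkℚᵘ i k)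

fromℕ-+ : ∀ m n → fromℕ (m ℕ.+ n) ≡ fromℕ m +ℚ fromℕ n
fromℕ-+ m n = ℚₚ.toℚᵘ-injective (begin
  toℚᵘ (fromℕ (m ℕ.+ n))              ≈⟨ toℚᵘ-/ (+ (m ℕ.+ n)) 1 ⟩
  mkℚᵘ (+ m ℤ.+ + n) 0                 ≈⟨ *≡* (ring (+ m) (+ n)) ⟩
  mkℚᵘ (+ m) 0 ℚᵘ.+ mkℚᵘ (+ n) 0       ≈⟨ ℚᵘₚ.+-cong (toℚᵘ-/ (+ m) 1) (toℚᵘ-/ (+ n) 1) ⟨
  toℚᵘ (fromℕ m) ℚᵘ.+ toℚᵘ (fromℕ n)   ≈⟨ ℚₚ.toℚᵘ-homo-+ (fromℕ m) (fromℕ n) ⟨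
  toℚᵘ (fromℕ m +ℚ fromℕ n)            ∎)
  where
  open ℚᵘₚ.≃-Reasoning
  ring : ∀ (i j : ℤ) → (i ℤ.+ j) ℤ.* (+ 1 ℤ.* + 1) ≡ (i ℤ.* + 1 ℤ.+ j ℤ.* + 1) ℤ.* + 1
  ring = solve-∀

/-*-cancel : ∀ a d .{{_ : NonZero d}} → (+ a / d) *ℚ fromℕ d ≡ fromℕ a
/-*-cancel a d@(suc k) = ℚₚ.toℚᵘ-injective (begin
  toℚᵘ ((+ a / d) *ℚ fromℕ d)          ≈⟨ ℚₚ.toℚᵘ-homo-* (+ a / d) (fromℕ d) ⟩
  toℚᵘ (+ a / d) ℚᵘ.* toℚᵘ (fromℕ d)   ≈⟨ ℚᵘₚ.*-cong (toℚᵘ-/ (+ a) d) (toℚᵘ-/ (+ d) 1) ⟩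
  mkℚᵘ (+ a) k ℚᵘ.* mkℚᵘ (+ d) 0       ≈⟨ *≡* (ring (+ a) (+ d)) ⟩
  mkℚᵘ (+ a) 0                         ≈⟨ toℚᵘ-/ (+ a) 1 ⟨
  toℚᵘ (fromℕ a)                       ∎)
  where
  open ℚᵘₚ.≃-Reasoning
  ring : ∀ (i j : ℤ) → (i ℤ.* j) ℤ.* + 1 ≡ i ℤ.* (j ℤ.* + 1)
  ring = solve-∀

/-cross-cong : ∀ a b c d .{{_ : NonZero b}} .{{_ : NonZero d}} →
               a * d ≡ c * b → + a / b ≡ + c / d
/-cross-cong a b@(suc _) c d@(suc _) ad≡cb = ℚₚ.toℚᵘ-injective (begin
  toℚᵘ (+ a / b)  ≈⟨ toℚᵘ-/ (+ a) b ⟩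
  + a ℚᵘ./ b      ≈⟨ *≡* (trans (sym (ℤₚ.pos-* a d)) (trans (cong +_ ad≡cb) (ℤₚ.pos-* c b))) ⟩
  + c ℚᵘ./ d      ≈⟨ toℚᵘ-/ (+ c) d ⟨
  toℚᵘ (+ c / d)  ∎)
  where open ℚᵘₚ.≃-Reasoning

0≤/ : ∀ a d .{{_ : NonZero d}} → 0ℚ ≤ℚ + a / d
0≤/ a d = ℚₚ.nonNegative⁻¹ (+ a / d) {{ℚₚ.normalize-nonNeg a d}}

/≤1 : ∀ {a d} .{{_ : NonZero d}} → a ≤ d → + a / d ≤ℚ 1ℚ
/≤1 {a} {d@(suc _)} a≤d = ℚₚ.toℚᵘ-cancel-≤ (ℚᵘₚ.≤-respˡ-≃ (ℚᵘₚ.≃-sym (toℚᵘ-/ (+ a) d))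
  (*≤* (subst₂ ℤ._≤_ (sym (ℤₚ.*-identityʳ (+ a))) (sym (ℤₚ.*-identityˡ (+ d))) (ℤ.+≤+ a≤d))))

sum-if-const : ∀ {A : Set} (P : A → Bool) (c : ℚ) (xs : List A) →
  foldr _+ℚ_ 0ℚ (map (λ y → if P y then c else 0ℚ) xs)
    ≡ c *ℚ fromℕ (sum (map (λ y → if P y then 1 else 0) xs))
sum-if-const P c [] = sym (ℚₚ.*-zeroʳ c)
sum-if-const P c (y ∷ xs) with P y
... | false = trans (ℚₚ.+-identityˡ _) (sum-if-const P c xs)
... | true = begin
  c +ℚ foldr _+ℚ_ 0ℚ (map (λ y → if P y then c else 0ℚ) xs)
                                      ≡⟨ cong (c +ℚ_) (sum-if-const P c xs) ⟩
  c +ℚ c *ℚ fromℕ s                   ≡⟨ cong (_+ℚ c *ℚ fromℕ s) (ℚₚ.*-identityʳ c) ⟨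
  c *ℚ 1ℚ +ℚ c *ℚ fromℕ s             ≡⟨ ℚₚ.*-distribˡ-+ c 1ℚ (fromℕ s) ⟨
  c *ℚ (1ℚ +ℚ fromℕ s)                ≡⟨ cong (c *ℚ_) (fromℕ-+ 1 s) ⟨
  c *ℚ fromℕ (suc s)                  ∎
  where
  open ≡-Reasoning
  s : ℕ
  s = sum (map (λ y → if P y then 1 else 0) xs)

sumE-const : (G : Graph) (c : Fin (n G) → ℚ) (x : Fin (n G)) →
             sumE G (λ x _ → c x) x ≡ c x *ℚ fromℕ (deg G x)
sumE-const G c x = sum-if-const (adj G x) (c x) (allFin (n G))

proportional⇒hasFractionalFactor : (G : Graph) (r : Fin (n G) → ℕ) →
  (∀ x → 0 < deg G x) → (∀ x → r x ≤ deg G x) →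
  (∀ x y → r x * deg G y ≡ r y * deg G x) →
  HasFractionalFactor G r
proportional⇒hasFractionalFactor G r deg-pos r≤deg r-prop = h , h-edge , h-sum
  where
  instance
    deg-nonZero : ∀ {x} → NonZero (deg G x)
    deg-nonZero {x} = ℕ.>-nonZero (deg-pos x)

  h : Fin (n G) → Fin (n G) → ℚ
  h x _ = + r x / deg G x

  h-edge : ∀ x y → adj G x y ≡ true → (h x y ≡ h y x) × (0ℚ ≤ℚ h x y) × (h x y ≤ℚ 1ℚ)
  h-edge x y _ = /-cross-cong (r x) (deg G x) (r y) (deg G y) (r-prop x y)
               , 0≤/ (r x) (deg G x)
               , /≤1 (r≤deg x)

  h-sum : ∀ x → sumE G h x ≡ fromℕ (r x)
  h-sum x = trans (sumE-const G (λ x → + r x / deg G x) x) (/-*-cancel (r x) (deg G x))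

corollary6 : (G : Graph) → (g f : Fin (n G) → ℕ) →
    (∀ x → 0 < g x) → (∀ x → 0 < f x) →
    (∀ x → (g x ≤ f x) × (f x ≤ deg G x)) →
    (∀ x y → deg G x * f y ≤ g x * deg G y) →
    ContainsAllFractionalFactors G g f
corollary6 G g f _ f-pos bounds cross r r-between =
  proportional⇒hasFractionalFactor G r deg-pos r≤deg r-proportional
  where
  deg-pos : ∀ x → 0 < deg G x
  deg-pos x = ℕₚ.≤-trans (f-pos x) (proj₂ (bounds x))

  r≤deg : ∀ x → r x ≤ deg G x
  r≤deg x = ℕₚ.≤-trans (proj₂ (r-between x)) (proj₂ (bounds x))

  deg*r≤r*deg : ∀ x y → deg G x * r y ≤ r x * deg G y
  deg*r≤r*deg x y = begin
    deg G x * r y  ≤⟨ ℕₚ.*-monoʳ-≤ (deg G x) (proj₂ (r-between y)) ⟩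
    deg G x * f y  ≤⟨ cross x y ⟩
    g x * deg G y  ≤⟨ ℕₚ.*-monoˡ-≤ (deg G y) (proj₁ (r-between x)) ⟩
    r x * deg G y  ∎
    where open ℕₚ.≤-Reasoning

  r-proportional : ∀ x y → r x * deg G y ≡ r y * deg G x
  r-proportional x y = ℕₚ.≤-antisym
    (subst (_≤ r y * deg G x) (ℕₚ.*-comm (deg G y) (r x)) (deg*r≤r*deg y x))
    (subst (_≤ r x * deg G y) (ℕₚ.*-comm (deg G x) (r y)) (deg*r≤r*deg x y))
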